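{- Let $q=2^r$, let $G_1=SO^+(2,q)$, $G_2=O^+(2,q)$, $G_3=SO^+(4,q)$, $N_i=|G_i|$, and let $\{C_{i,j}\}_{j=0}^{N_i}$ be the weight distribution of $C(G_i)$. Then for $i=1,2,3$ and all $0\le j\le N_i$, $C_{i,j}=C_{i,N_i-j}$.
   Context: $\mathrm{Tr}$ is the matrix trace. For a finite group $G$ of matrices over $\mathbb{F}_q$ with elements listed as $g_1,\ldots,g_N$, $C(G)=\{u\in\mathbb{F}_2^N:\ \sum_{j=1}^N u_j\,\mathrm{Tr}(g_j)=0\text{ in }\mathbb{F}_q\}$, and $C_j$ is the number of its codewords of Hamming weight $j$. On column vectors $x\in\mathbb{F}_q^{2n}$ let $\theta^+(x)=\sum_{i=1}^n x_ix_{n+i}$; $O^+(2n,q)$ is the group of $g\in GL(2n,q)$ preserving $\theta^+$; equivalently, writing $g=\begin{bmatrix}A&B\\C&D\end{bmatrix}$ with $n\times n$ blocks, ${}^tAC,{}^tBD$ are alternating (symmetric with zero diagonal) and ${}^tAD+{}^tCB=1_n$. The map $\delta^+(g)=\mathrm{Tr}(B\,{}^tC)$ is a surjective homomorphism $O^+(2n,q)\to\mathbb{F}_2$ and $SO^+(2n,q)=\ker\delta^+$. -}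

module Defs where

open import Level using (0ℓ)
open import Data.Nat using (ℕ; zero; suc; _^_; _∸_; _≤_)
import Data.Nat as ℕ
open import Data.Bool using (Bool; true; false)
import Data.Fin
open import Data.Fin using (Fin; _↑ˡ_; _↑ʳ_)
open import Data.Vec using (Vec; lookup; tabulate; toList; _∷_; [])
open import Data.List using (List; length; filter; map; concatMap; [_]) renaming ([] to []ₗ; _∷_ to _∷ₗ_)
open import Data.List.Membership.Propositional using (_∈_)
open import Data.List.Relation.Unary.Unique.Propositional using (Unique)
open import Data.Product using (Σ; _×_; _,_; ∃)
open import Function.Bundles using (_↔_; Inverse)
open import Relation.Binary.PropositionalEquality using (_≡_; _≢_; cong)
open import Relation.Binary.Definitions using (DecidableEquality)
open import Relation.Nullary using (yes; no)
open import Relation.Nullary.Decidable using (_×-dec_; map′)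
import Algebra.Structures as AS
import Data.Fin.Properties as FinP
import Relation.Binary.PropositionalEquality

record FiniteField (r : ℕ) : Set₁ where
  field
    Carrier : Set
    _+_ : Carrier → Carrier → Carrier
    _*_ : Carrier → Carrier → Carrier
    -_  : Carrier → Carrier
    0#  : Carrier
    1#  : Carrier
    isCommutativeRing : AS.IsCommutativeRing _≡_ _+_ _*_ -_ 0# 1#
    0≢1 : 0# ≢ 1#
    *-inverse : ∀ x → x ≢ 0# → ∃ λ y → x * y ≡ 1#
    enumeration : Fin (2 ^ r) ↔ Carrier

  infixl 6 _+_
  infixl 7 _*_

  _≟_ : DecidableEquality Carrier
  x ≟ y = map′ (λ e → trans′ e) (cong from) (from x FinP.≟ from y)
    where
      open Inverse enumeration
      trans′ : from x ≡ from y → x ≡ y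
      trans′ e = Relation.Binary.PropositionalEquality.trans (Relation.Binary.PropositionalEquality.sym (strictlyInverseˡ x))
                   (Relation.Binary.PropositionalEquality.trans (cong to e) (strictlyInverseˡ y))

allBoolVecs : (N : ℕ) → List (Vec Bool N)
allBoolVecs zero = [ [] ]
allBoolVecs (suc N) = concatMap (λ b → map (b ∷_) (allBoolVecs N)) (true ∷ₗ false ∷ₗ []ₗ)

weight : ∀ {N} → Vec Bool N → ℕ
weight [] = 0
weight (true ∷ u) = suc (weight u)
weight (false ∷ u) = weight u

module FieldDefs {r : ℕ} (F : FiniteField r) where
  open FiniteField F

  Σ[<_] : (n : ℕ) → (Fin n → Carrier) → Carrier
  Σ[< zero ] f = 0#
  Σ[< suc n ] f = f Data.Fin.zero + Σ[< n ] (λ i → f (Data.Fin.suc i))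

  Mat : ℕ → Set
  Mat m = Vec (Vec Carrier m) m

  entry : ∀ {m} → Mat m → Fin m → Fin m → Carrier
  entry g i j = lookup (lookup g i) j

  _·_ : ∀ {m} → Mat m → Mat m → Mat m
  g · h = tabulate λ i → tabulate λ j → Σ[< _ ] (λ k → entry g i k * entry h k j)

  identity : ∀ m → Mat m
  identity m = tabulate λ i → tabulate λ j → δ i j
    where
      δ : Fin m → Fin m → Carrier
      δ i j with i FinP.≟ j
      ... | yes _ = 1#
      ... | no _ = 0#

  _▹_ : ∀ {m} → Mat m → (Fin m → Carrier) → (Fin m → Carrier)
  (g ▹ x) i = Σ[< _ ] (λ k → entry g i k * x k)

  Tr : ∀ {m} → Mat m → Carrier
  Tr {m} g = Σ[< m ] (λ i → entry g i i)

  IsInvertible : ∀ {m} → Mat m → Set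
  IsInvertible {m} g = Σ (Mat m) λ h → (g · h ≡ identity m) × (h · g ≡ identity m)

  θ⁺ : (n : ℕ) → (Fin (n ℕ.+ n) → Carrier) → Carrier
  θ⁺ n x = Σ[< n ] (λ i → x (i ↑ˡ n) * x (n ↑ʳ i))

  InO⁺ : (n : ℕ) → Mat (n ℕ.+ n) → Set
  InO⁺ n g = IsInvertible g × (∀ x → θ⁺ n (g ▹ x) ≡ θ⁺ n x)

  -- δ⁺(g) = Tr(B ᵗC) for g = [[A,B],[C,D]]
  δ⁺ : (n : ℕ) → Mat (n ℕ.+ n) → Carrier
  δ⁺ n g = Σ[< n ] λ i → Σ[< n ] λ k → B i k * C i k
    where
      B C : Fin n → Fin n → Carrier
      B i k = entry g (i ↑ˡ n) (n ↑ʳ k)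
      C i k = entry g (n ↑ʳ i) (k ↑ˡ n)

  InSO⁺ : (n : ℕ) → Mat (n ℕ.+ n) → Set
  InSO⁺ n g = InO⁺ n g × (δ⁺ n g ≡ 0#)

  codeSum : ∀ {m} → List Bool → List (Mat m) → Carrier
  codeSum (true ∷ₗ u) (g ∷ₗ gs) = Tr g + codeSum u gs
  codeSum (false ∷ₗ u) (g ∷ₗ gs) = codeSum u gs
  codeSum _ _ = 0#

  InCode : ∀ {m} (gs : List (Mat m)) → Vec Bool (length gs) → Set
  InCode gs u = codeSum (toList u) gs ≡ 0#

  weightCount : ∀ {m} (gs : List (Mat m)) → ℕ → ℕ
  weightCount gs j =
    length (filter (λ u → (weight u ℕ.≟ j) ×-dec (codeSum (toList u) gs ≟ 0#))
                   (allBoolVecs (length gs)))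

  SymmetricWeightDistribution : ∀ {m} → (Mat m → Set) → Set
  SymmetricWeightDistribution {m} G =
    (gs : List (Mat m)) → Unique gs → (∀ g → (g ∈ gs → G g) × (G g → g ∈ gs)) →
    ∀ j → j ≤ length gs → weightCount gs j ≡ weightCount gs (length gs ∸ j)

-- F_q has characteristic 2: the shift x ↦ x + 1 permutes F_q, so q · 1 = 0, and F_q has no
-- zero divisors. For g = [[A,B],[C,D]], conjugation by J = [[0,1],[1,0]] preserves θ⁺ and δ⁺
-- and exchanges A and D, so it permutes O⁺(2n,q) and SO⁺(2n,q); hence the traces over either
-- group sum to Σ Tr A + Σ Tr D = 2 Σ Tr A = 0, for every n. Then a word u and its complement
-- have trace sums adding up to 0, so complementation maps the codewords of weight j
-- bijectively onto those of weight N ∸ j.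

module Submission where

open import Defs
open import Level using (0ℓ)
open import Algebra.Bundles using (CommutativeRing)
import Algebra.Properties.CommutativeSemigroup as CommutativeSemigroupProperties
import Algebra.Properties.Semiring.Mult as SemiringMultProperties
import Algebra.Properties.Group as GroupProperties
open import Data.Bool using (Bool; true; false; not)
open import Data.Fin using (Fin; _↑ˡ_; _↑ʳ_; splitAt; join)
import Data.Fin as Fin
open import Data.Fin.Properties using (splitAt-↑ˡ; splitAt-↑ʳ; splitAt-join; join-splitAt)
import Data.Fin.Properties as FinP
open import Data.List using (List; length; filter; map; foldr; _++_) renaming ([] to []ₗ; _∷_ to _∷ₗ_)
import Data.List as List
open import Data.List.Properties using (filter-++; length-++; ++-identityʳ; map-∘; map-cong; length-tabulate)
open import Data.List.Membership.Propositional using (_∈_)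
open import Data.List.Membership.Propositional.Properties using (∈-map⁺; ∈-map⁻; ∈-tabulate⁺)
open import Data.List.Membership.Propositional.Properties.WithK using (unique∧set⇒bag)
open import Data.List.Relation.Binary.BagAndSetEquality using (∼bag⇒↭)
open import Data.List.Relation.Binary.Permutation.Propositional using (_↭_; ↭⇒↭ₛ)
import Data.List.Relation.Binary.Permutation.Propositional.Properties as ↭
import Data.List.Relation.Binary.Permutation.Setoid.Properties as ↭ₛ
open import Data.List.Relation.Unary.Unique.Propositional using (Unique)
import Data.List.Relation.Unary.Unique.Propositional.Properties as Unique
open import Data.Nat using (ℕ; zero; suc; _∸_; _≤_; _^_)
import Data.Nat as ℕ
open import Data.Nat.Properties using (+-suc; m+n∸m≡n; m+n∸n≡m; m∸[m∸n]≡n)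
import Data.Nat.Properties as ℕ
open import Data.Product using (_×_; _,_; proj₁; proj₂)
open import Data.Product.Function.NonDependent.Propositional using (_×-⇔_)
import Data.Sum as Sum
open import Data.Sum.Properties using (swap-involutive)
open import Data.Vec using (Vec; _∷_; []; tabulate; lookup; toList)
import Data.Vec as Vec
open import Data.Vec.Properties using (lookup∘tabulate; tabulate∘lookup; tabulate-cong)
open import Function using (_∘_)
open import Function.Bundles using (_⇔_; mk⇔; Equivalence; Inverse)
open import Relation.Binary.PropositionalEquality
  using (_≡_; _≢_; refl; sym; trans; cong; cong₂; subst; setoid; module ≡-Reasoning)
open import Relation.Nullary using (yes; no; does; contradiction)
open import Relation.Unary using (Pred; Decidable)

weight-complement : ∀ {N} (u : Vec Bool N) → weight (Vec.map not u) ℕ.+ weight u ≡ N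
weight-complement []          = refl
weight-complement (true ∷ u)  = trans (+-suc _ _) (cong suc (weight-complement u))
weight-complement (false ∷ u) = cong suc (weight-complement u)

length-filter-map : ∀ {A B : Set} {P : Pred B 0ℓ} (P? : Decidable P) (f : A → B) (xs : List A) →
  length (filter P? (map f xs)) ≡ length (filter (P? ∘ f) xs)
length-filter-map P? f []ₗ = refl
length-filter-map P? f (x ∷ₗ xs) with does (P? (f x))
... | true  = cong suc (length-filter-map P? f xs)
... | false = length-filter-map P? f xs

length-filter-allBoolVecs-suc : ∀ {N} {P : Pred (Vec Bool (suc N)) 0ℓ} (P? : Decidable P) →
  length (filter P? (allBoolVecs (suc N))) ≡
  length (filter (P? ∘ (true ∷_)) (allBoolVecs N)) ℕ.+ length (filter (P? ∘ (false ∷_)) (allBoolVecs N))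
length-filter-allBoolVecs-suc {N} P? = begin
  length (filter P? (map (true ∷_) A ++ map (false ∷_) A ++ []ₗ))
    ≡⟨ cong length (filter-++ P? (map (true ∷_) A) _) ⟩
  length (filter P? (map (true ∷_) A) ++ filter P? (map (false ∷_) A ++ []ₗ))
    ≡⟨ length-++ (filter P? (map (true ∷_) A)) ⟩
  length (filter P? (map (true ∷_) A)) ℕ.+ length (filter P? (map (false ∷_) A ++ []ₗ))
    ≡⟨ cong₂ ℕ._+_ (length-filter-map P? (true ∷_) A)
                   (trans (cong (length ∘ filter P?) (++-identityʳ (map (false ∷_) A))) (length-filter-map P? (false ∷_) A)) ⟩
  length (filter (P? ∘ (true ∷_)) A) ℕ.+ length (filter (P? ∘ (false ∷_)) A) ∎
  where
    A = allBoolVecs N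
    open ≡-Reasoning

length-filter-allBoolVecs-complement : ∀ {N} {P Q : Pred (Vec Bool N) 0ℓ} (P? : Decidable P) (Q? : Decidable Q) →
  (∀ u → P (Vec.map not u) ⇔ Q u) →
  length (filter P? (allBoolVecs N)) ≡ length (filter Q? (allBoolVecs N))
length-filter-allBoolVecs-complement {zero} P? Q? P⇔Q with P? [] | Q? []
... | yes _ | yes _ = refl
... | no _  | no _  = refl
... | yes p | no ¬q = contradiction (Equivalence.to (P⇔Q []) p) ¬q
... | no ¬p | yes q = contradiction (Equivalence.from (P⇔Q []) q) ¬p
length-filter-allBoolVecs-complement {suc N} P? Q? P⇔Q = begin
  length (filter P? (allBoolVecs (suc N)))
    ≡⟨ length-filter-allBoolVecs-suc P? ⟩
  #P (true ∷_) ℕ.+ #P (false ∷_)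
    ≡⟨ cong₂ ℕ._+_ (length-filter-allBoolVecs-complement _ _ (P⇔Q ∘ (false ∷_)))
                   (length-filter-allBoolVecs-complement _ _ (P⇔Q ∘ (true ∷_))) ⟩
  #Q (false ∷_) ℕ.+ #Q (true ∷_)
    ≡⟨ ℕ.+-comm (#Q (false ∷_)) _ ⟩
  #Q (true ∷_) ℕ.+ #Q (false ∷_)
    ≡⟨ length-filter-allBoolVecs-suc Q? ⟨
  length (filter Q? (allBoolVecs (suc N))) ∎
  where
    #P #Q : (Vec Bool N → Vec Bool (suc N)) → ℕ
    #P f = length (filter (P? ∘ f) (allBoolVecs N))
    #Q f = length (filter (Q? ∘ f) (allBoolVecs N))
    open ≡-Reasoning

m+n≡o⇒[m≡j⇔n≡o∸j] : ∀ {m n o j} → m ℕ.+ n ≡ o → j ≤ o → (m ≡ j) ⇔ (n ≡ o ∸ j)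
m+n≡o⇒[m≡j⇔n≡o∸j] {m} {n} {o} {j} m+n≡o j≤o = mk⇔
  (λ { refl → trans (sym (m+n∸m≡n m n)) (cong (_∸ m) m+n≡o) })
  (λ { refl → trans (sym (m+n∸n≡m m n)) (trans (cong (_∸ n) m+n≡o) (m∸[m∸n]≡n j≤o)) })

map-↭ : ∀ {A : Set} {xs : List A} (φ ψ : A → A) →
  (∀ x → ψ (φ x) ≡ x) → (∀ x → φ (ψ x) ≡ x) →
  (∀ {x} → x ∈ xs → φ x ∈ xs) → (∀ {x} → x ∈ xs → ψ x ∈ xs) →
  Unique xs → map φ xs ↭ xs
map-↭ {xs = xs} φ ψ ψφ φψ φ∈ ψ∈ !xs = ∼bag⇒↭ (unique∧set⇒bag (Unique.map⁺ φ-injective !xs) !xs (mk⇔ to from))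
  where
    φ-injective : ∀ {x y} → φ x ≡ φ y → x ≡ y
    φ-injective {x} {y} φx≡φy = trans (sym (ψφ x)) (trans (cong ψ φx≡φy) (ψφ y))
    to : ∀ {x} → x ∈ map φ xs → x ∈ xs
    to x∈ with y , y∈ , refl ← ∈-map⁻ φ x∈ = φ∈ y∈
    from : ∀ {x} → x ∈ xs → x ∈ map φ xs
    from {x} x∈ = subst (_∈ map φ xs) (φψ x) (∈-map⁺ φ (ψ∈ x∈))

module _ {r : ℕ} (F : FiniteField r) where
  open FiniteField F
  open FieldDefs F

  commutativeRing : CommutativeRing 0ℓ 0ℓ
  commutativeRing = record { isCommutativeRing = isCommutativeRing }

  open CommutativeRing commutativeRing
    using ( +-comm; +-assoc; +-identityˡ; +-identityʳ; -‿inverseˡ; -‿inverseʳ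
          ; *-comm; *-assoc; *-identityˡ; zeroˡ; zeroʳ
          ; +-isCommutativeMonoid; +-commutativeSemigroup; +-group; semiring)
  open GroupProperties +-group using (identityˡ-unique; identityʳ-unique)
  open CommutativeSemigroupProperties +-commutativeSemigroup using (interchange; x∙yz≈y∙xz)
  open SemiringMultProperties semiring using (×1-homo-*; ×-assoc-*) renaming (_×_ to _×₊_)

  sum : List Carrier → Carrier
  sum = foldr _+_ 0#

  sum-↭ : ∀ {xs ys} → xs ↭ ys → sum xs ≡ sum ys
  sum-↭ p = ↭ₛ.foldr-commMonoid (setoid Carrier) +-isCommutativeMonoid (↭⇒↭ₛ p)

  sum-map-+ : ∀ {A : Set} (f g : A → Carrier) (xs : List A) →
    sum (map (λ x → f x + g x) xs) ≡ sum (map f xs) + sum (map g xs)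
  sum-map-+ f g []ₗ = sym (+-identityʳ 0#)
  sum-map-+ f g (x ∷ₗ xs) = trans (cong (f x + g x +_) (sum-map-+ f g xs)) (interchange _ _ _ _)

  sum-map-+-const : ∀ (a : Carrier) (xs : List Carrier) → sum (map (_+ a) xs) ≡ sum xs + length xs ×₊ a
  sum-map-+-const a []ₗ = sym (+-identityʳ 0#)
  sum-map-+-const a (x ∷ₗ xs) = trans (cong (x + a +_) (sum-map-+-const a xs)) (interchange _ _ _ _)

  sum-map-∘-↭ : ∀ {A : Set} {xs : List A} (f : A → Carrier) (φ : A → A) → map φ xs ↭ xs →
    sum (map (f ∘ φ) xs) ≡ sum (map f xs)
  sum-map-∘-↭ {xs = xs} f φ p = trans (cong sum (map-∘ xs)) (sum-↭ (↭.map⁺ f p))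

  elements : List Carrier
  elements = List.tabulate (Inverse.to enumeration)

  ∈-elements : ∀ x → x ∈ elements
  ∈-elements x = subst (_∈ elements) (Inverse.strictlyInverseˡ enumeration x) (∈-tabulate⁺ _)

  elements-unique : Unique elements
  elements-unique = Unique.tabulate⁺ λ {i} {j} e →
    trans (sym (Inverse.strictlyInverseʳ enumeration i))
          (trans (cong (Inverse.from enumeration) e) (Inverse.strictlyInverseʳ enumeration j))

  2^r×a≡0 : ∀ a → (2 ^ r) ×₊ a ≡ 0#
  2^r×a≡0 a = begin
    (2 ^ r) ×₊ a          ≡⟨ cong (_×₊ a) (length-tabulate (Inverse.to enumeration)) ⟨
    length elements ×₊ a  ≡⟨ identityʳ-unique (sum elements) _ (trans (sym (sum-map-+-const a elements)) (sum-↭ shift↭)) ⟩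
    0#                    ∎
    where
      open ≡-Reasoning
      shift↭ : map (_+ a) elements ↭ elements
      shift↭ = map-↭ (_+ a) (_+ - a)
        (λ x → trans (+-assoc x a (- a)) (trans (cong (x +_) (-‿inverseʳ a)) (+-identityʳ x)))
        (λ x → trans (+-assoc x (- a) a) (trans (cong (x +_) (-‿inverseˡ a)) (+-identityʳ x)))
        (λ {x} _ → ∈-elements (x + a)) (λ {x} _ → ∈-elements (x + - a)) elements-unique

  x≢0∧x*y≡0⇒y≡0 : ∀ {x y} → x ≢ 0# → x * y ≡ 0# → y ≡ 0#
  x≢0∧x*y≡0⇒y≡0 {x} {y} x≢0 xy≡0 with x⁻¹ , xx⁻¹≡1 ← *-inverse x x≢0 = begin
    y              ≡⟨ *-identityˡ y ⟨
    1# * y         ≡⟨ cong (_* y) (trans (sym xx⁻¹≡1) (*-comm x x⁻¹)) ⟩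
    x⁻¹ * x * y    ≡⟨ *-assoc x⁻¹ x y ⟩
    x⁻¹ * (x * y)  ≡⟨ cong (x⁻¹ *_) xy≡0 ⟩
    x⁻¹ * 0#       ≡⟨ zeroʳ x⁻¹ ⟩
    0#             ∎
    where open ≡-Reasoning

  2^k×1≡0⇒2×1≡0 : ∀ k → (2 ^ k) ×₊ 1# ≡ 0# → 2 ×₊ 1# ≡ 0#
  2^k×1≡0⇒2×1≡0 zero 1+0≡0 = contradiction (trans (sym 1+0≡0) (+-identityʳ 1#)) 0≢1
  2^k×1≡0⇒2×1≡0 (suc k) 2^[1+k]×1≡0 with (2 ×₊ 1#) ≟ 0#
  ... | yes 2×1≡0 = 2×1≡0
  ... | no 2×1≢0  = 2^k×1≡0⇒2×1≡0 k (x≢0∧x*y≡0⇒y≡0 2×1≢0 (trans (sym (×1-homo-* 2 (2 ^ k))) 2^[1+k]×1≡0))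

  2×1≡0 : 2 ×₊ 1# ≡ 0#
  2×1≡0 = 2^k×1≡0⇒2×1≡0 r (2^r×a≡0 1#)

  x+x≡0 : ∀ x → x + x ≡ 0#
  x+x≡0 x = begin
    x + x                   ≡⟨ cong (x +_) (+-identityʳ x) ⟨
    x + (x + 0#)            ≡⟨ cong (λ y → y + (y + 0#)) (*-identityˡ x) ⟨
    2 ×₊ (1# * x)           ≡⟨ ×-assoc-* 2 1# x ⟨
    (2 ×₊ 1#) * x           ≡⟨ cong (_* x) 2×1≡0 ⟩
    0# * x                  ≡⟨ zeroˡ x ⟩
    0#                      ∎
    where open ≡-Reasoning

  x+y≡0⇒[x≡0⇔y≡0] : ∀ {x y} → x + y ≡ 0# → (x ≡ 0#) ⇔ (y ≡ 0#)
  x+y≡0⇒[x≡0⇔y≡0] {x} {y} x+y≡0 = mk⇔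
    (λ x≡0 → identityʳ-unique x y (trans x+y≡0 (sym x≡0)))
    (λ y≡0 → identityˡ-unique x y (trans x+y≡0 (sym y≡0)))

  codeSum-complement : ∀ {m} (gs : List (Mat m)) (u : Vec Bool (length gs)) →
    codeSum (toList (Vec.map not u)) gs + codeSum (toList u) gs ≡ sum (map Tr gs)
  codeSum-complement []ₗ [] = +-identityʳ 0#
  codeSum-complement (g ∷ₗ gs) (true ∷ u) =
    trans (x∙yz≈y∙xz _ (Tr g) _) (cong (Tr g +_) (codeSum-complement gs u))
  codeSum-complement (g ∷ₗ gs) (false ∷ u) =
    trans (+-assoc (Tr g) _ _) (cong (Tr g +_) (codeSum-complement gs u))

  traceSum≡0⇒weightCount-symmetric : ∀ {m} (gs : List (Mat m)) → sum (map Tr gs) ≡ 0# →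
    ∀ j → j ≤ length gs → weightCount gs j ≡ weightCount gs (length gs ∸ j)
  traceSum≡0⇒weightCount-symmetric gs ΣTr≡0 j j≤N =
    length-filter-allBoolVecs-complement _ _ λ u →
      m+n≡o⇒[m≡j⇔n≡o∸j] (weight-complement u) j≤N
      ×-⇔ x+y≡0⇒[x≡0⇔y≡0] (trans (codeSum-complement gs u) ΣTr≡0)

  Σ[<]-cong : ∀ {k} {f g : Fin k → Carrier} → (∀ i → f i ≡ g i) → Σ[< k ] f ≡ Σ[< k ] g
  Σ[<]-cong {zero}  f≗g = refl
  Σ[<]-cong {suc k} f≗g = cong₂ _+_ (f≗g Fin.zero) (Σ[<]-cong (f≗g ∘ Fin.suc))

  Σ[<]-+ : ∀ m k (f : Fin (m ℕ.+ k) → Carrier) →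
    Σ[< m ℕ.+ k ] f ≡ Σ[< m ] (λ i → f (i ↑ˡ k)) + Σ[< k ] (λ i → f (m ↑ʳ i))
  Σ[<]-+ zero    k f = sym (+-identityˡ _)
  Σ[<]-+ (suc m) k f = trans (cong (f Fin.zero +_) (Σ[<]-+ m k (f ∘ Fin.suc))) (sym (+-assoc _ _ _))

  -- stated for any M that is definitionally a tabulation, so that T is inferred from the definition of M
  -- (e.g. the entry function of identity, which is local to its definition)
  entry-tabulated : ∀ {m} {T : Fin m → Fin m → Carrier} (M : Mat m) → M ≡ tabulate (λ i → tabulate (T i)) →
    ∀ a b → entry M a b ≡ T a b
  entry-tabulated {T = T} M refl a b rewrite lookup∘tabulate (λ i → tabulate (T i)) a = lookup∘tabulate (T a) b

  entry-identity-injective : ∀ m (σ : Fin m → Fin m) → (∀ {i j} → σ i ≡ σ j → i ≡ j) → ∀ i j →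
    entry (identity m) (σ i) (σ j) ≡ entry (identity m) i j
  entry-identity-injective m σ σ-injective i j
    rewrite entry-tabulated (identity m) refl (σ i) (σ j) | entry-tabulated (identity m) refl i j
    with σ i FinP.≟ σ j | i FinP.≟ j
  ... | yes _      | yes _   = refl
  ... | no _       | no _    = refl
  ... | yes σi≡σj  | no i≢j  = contradiction (σ-injective σi≡σj) i≢j
  ... | no σi≢σj   | yes i≡j = contradiction (cong σ i≡j) σi≢σj

  module SwapHalves (n : ℕ) where

    swapHalves : Fin (n ℕ.+ n) → Fin (n ℕ.+ n)
    swapHalves = join n n ∘ Sum.swap ∘ splitAt n

    swapHalves-↑ˡ : ∀ i → swapHalves (i ↑ˡ n) ≡ n ↑ʳ i
    swapHalves-↑ˡ i = cong (join n n ∘ Sum.swap) (splitAt-↑ˡ n i n)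

    swapHalves-↑ʳ : ∀ i → swapHalves (n ↑ʳ i) ≡ i ↑ˡ n
    swapHalves-↑ʳ i = cong (join n n ∘ Sum.swap) (splitAt-↑ʳ n n i)

    swapHalves-involutive : ∀ i → swapHalves (swapHalves i) ≡ i
    swapHalves-involutive i = begin
      join n n (Sum.swap (splitAt n (join n n (Sum.swap (splitAt n i)))))
        ≡⟨ cong (join n n ∘ Sum.swap) (splitAt-join n n (Sum.swap (splitAt n i))) ⟩
      join n n (Sum.swap (Sum.swap (splitAt n i)))
        ≡⟨ cong (join n n) (swap-involutive (splitAt n i)) ⟩
      join n n (splitAt n i)
        ≡⟨ join-splitAt n n i ⟩
      i ∎
      where open ≡-Reasoning

    swapHalves-injective : ∀ {i j} → swapHalves i ≡ swapHalves j → i ≡ j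
    swapHalves-injective {i} {j} e =
      trans (sym (swapHalves-involutive i)) (trans (cong swapHalves e) (swapHalves-involutive j))

    Σ[<]-swapHalves : ∀ f → Σ[< n ℕ.+ n ] (f ∘ swapHalves) ≡ Σ[< n ℕ.+ n ] f
    Σ[<]-swapHalves f = begin
      Σ[< n ℕ.+ n ] (f ∘ swapHalves)
        ≡⟨ Σ[<]-+ n n (f ∘ swapHalves) ⟩
      Σ[< n ] (λ i → f (swapHalves (i ↑ˡ n))) + Σ[< n ] (λ i → f (swapHalves (n ↑ʳ i)))
        ≡⟨ cong₂ _+_ (Σ[<]-cong (cong f ∘ swapHalves-↑ˡ)) (Σ[<]-cong (cong f ∘ swapHalves-↑ʳ)) ⟩
      Σ[< n ] (λ i → f (n ↑ʳ i)) + Σ[< n ] (λ i → f (i ↑ˡ n))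
        ≡⟨ +-comm _ _ ⟩
      Σ[< n ] (λ i → f (i ↑ˡ n)) + Σ[< n ] (λ i → f (n ↑ʳ i))
        ≡⟨ Σ[<]-+ n n f ⟨
      Σ[< n ℕ.+ n ] f ∎
      where open ≡-Reasoning

    -- J g J for J the matrix of swapHalves: [[A,B],[C,D]] ↦ [[D,C],[B,A]]
    conjSwap : Mat (n ℕ.+ n) → Mat (n ℕ.+ n)
    conjSwap g = tabulate λ i → tabulate λ j → entry g (swapHalves i) (swapHalves j)

    entry-conjSwap : ∀ g a b → entry (conjSwap g) a b ≡ entry g (swapHalves a) (swapHalves b)
    entry-conjSwap g = entry-tabulated (conjSwap g) refl

    conjSwap-involutive : ∀ g → conjSwap (conjSwap g) ≡ g
    conjSwap-involutive g = begin
      conjSwap (conjSwap g)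
        ≡⟨ tabulate-cong (λ i → tabulate-cong (λ j →
             trans (entry-conjSwap g (swapHalves i) (swapHalves j))
                   (cong₂ (entry g) (swapHalves-involutive i) (swapHalves-involutive j)))) ⟩
      tabulate (λ i → tabulate (lookup (lookup g i)))
        ≡⟨ tabulate-cong (tabulate∘lookup ∘ lookup g) ⟩
      tabulate (lookup g)
        ≡⟨ tabulate∘lookup g ⟩
      g ∎
      where open ≡-Reasoning

    conjSwap-identity : conjSwap (identity (n ℕ.+ n)) ≡ identity (n ℕ.+ n)
    conjSwap-identity = tabulate-cong λ i → tabulate-cong λ j →
      trans (entry-identity-injective (n ℕ.+ n) swapHalves swapHalves-injective i j)
            (entry-tabulated (identity (n ℕ.+ n)) refl i j)

    conjSwap-· : ∀ g h → conjSwap (g · h) ≡ conjSwap g · conjSwap h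
    conjSwap-· g h = tabulate-cong λ i → tabulate-cong λ j → begin
      entry (g · h) (swapHalves i) (swapHalves j)
        ≡⟨ entry-tabulated (g · h) refl (swapHalves i) (swapHalves j) ⟩
      Σ[< n ℕ.+ n ] (λ k → entry g (swapHalves i) k * entry h k (swapHalves j))
        ≡⟨ Σ[<]-swapHalves (λ k → entry g (swapHalves i) k * entry h k (swapHalves j)) ⟨
      Σ[< n ℕ.+ n ] (λ k → entry g (swapHalves i) (swapHalves k) * entry h (swapHalves k) (swapHalves j))
        ≡⟨ Σ[<]-cong (λ k → sym (cong₂ _*_ (entry-conjSwap g i k) (entry-conjSwap h k j))) ⟩
      Σ[< n ℕ.+ n ] (λ k → entry (conjSwap g) i k * entry (conjSwap h) k j) ∎
      where open ≡-Reasoning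

    conjSwap-IsInvertible : ∀ g → IsInvertible g → IsInvertible (conjSwap g)
    conjSwap-IsInvertible g (h , gh≡1 , hg≡1) =
      conjSwap h ,
      trans (sym (conjSwap-· g h)) (trans (cong conjSwap gh≡1) conjSwap-identity) ,
      trans (sym (conjSwap-· h g)) (trans (cong conjSwap hg≡1) conjSwap-identity)

    conjSwap-▹ : ∀ g x i → (conjSwap g ▹ x) i ≡ (g ▹ (x ∘ swapHalves)) (swapHalves i)
    conjSwap-▹ g x i = begin
      Σ[< n ℕ.+ n ] (λ k → entry (conjSwap g) i k * x k)
        ≡⟨ Σ[<]-cong (λ k → cong₂ _*_ (entry-conjSwap g i k) (cong x (sym (swapHalves-involutive k)))) ⟩
      Σ[< n ℕ.+ n ] (λ k → entry g (swapHalves i) (swapHalves k) * x (swapHalves (swapHalves k)))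
        ≡⟨ Σ[<]-swapHalves (λ k → entry g (swapHalves i) k * x (swapHalves k)) ⟩
      Σ[< n ℕ.+ n ] (λ k → entry g (swapHalves i) k * x (swapHalves k)) ∎
      where open ≡-Reasoning

    θ⁺-swapHalves : ∀ y → θ⁺ n (y ∘ swapHalves) ≡ θ⁺ n y
    θ⁺-swapHalves y = Σ[<]-cong λ i →
      trans (cong₂ _*_ (cong y (swapHalves-↑ˡ i)) (cong y (swapHalves-↑ʳ i))) (*-comm _ _)

    θ⁺-cong : ∀ {y z} → (∀ i → y i ≡ z i) → θ⁺ n y ≡ θ⁺ n z
    θ⁺-cong y≗z = Σ[<]-cong {n} λ i → cong₂ _*_ (y≗z (i ↑ˡ n)) (y≗z (n ↑ʳ i))

    conjSwap-InO⁺ : ∀ g → InO⁺ n g → InO⁺ n (conjSwap g)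
    conjSwap-InO⁺ g (g-invertible , g-preserves-θ⁺) = conjSwap-IsInvertible g g-invertible , λ x → begin
      θ⁺ n (conjSwap g ▹ x)                      ≡⟨ θ⁺-cong (conjSwap-▹ g x) ⟩
      θ⁺ n ((g ▹ (x ∘ swapHalves)) ∘ swapHalves) ≡⟨ θ⁺-swapHalves (g ▹ (x ∘ swapHalves)) ⟩
      θ⁺ n (g ▹ (x ∘ swapHalves))                ≡⟨ g-preserves-θ⁺ (x ∘ swapHalves) ⟩
      θ⁺ n (x ∘ swapHalves)                      ≡⟨ θ⁺-swapHalves x ⟩
      θ⁺ n x                                     ∎
      where open ≡-Reasoning

    δ⁺-conjSwap : ∀ g → δ⁺ n (conjSwap g) ≡ δ⁺ n g
    δ⁺-conjSwap g = Σ[<]-cong λ i → Σ[<]-cong λ k → trans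
      (cong₂ _*_ (trans (entry-conjSwap g (i ↑ˡ n) (n ↑ʳ k)) (cong₂ (entry g) (swapHalves-↑ˡ i) (swapHalves-↑ʳ k)))
                 (trans (entry-conjSwap g (n ↑ʳ i) (k ↑ˡ n)) (cong₂ (entry g) (swapHalves-↑ʳ i) (swapHalves-↑ˡ k))))
      (*-comm _ _)

    conjSwap-InSO⁺ : ∀ g → InSO⁺ n g → InSO⁺ n (conjSwap g)
    conjSwap-InSO⁺ g (g∈O⁺ , δ⁺g≡0) = conjSwap-InO⁺ g g∈O⁺ , trans (δ⁺-conjSwap g) δ⁺g≡0

    topLeftTrace : Mat (n ℕ.+ n) → Carrier
    topLeftTrace g = Σ[< n ] λ i → entry g (i ↑ˡ n) (i ↑ˡ n)

    Tr≡topLeftTrace+topLeftTrace∘conjSwap : ∀ g → Tr g ≡ topLeftTrace g + topLeftTrace (conjSwap g)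
    Tr≡topLeftTrace+topLeftTrace∘conjSwap g = trans (Σ[<]-+ n n (λ i → entry g i i)) (cong (topLeftTrace g +_) (sym
      (Σ[<]-cong λ i → trans (entry-conjSwap g (i ↑ˡ n) (i ↑ˡ n)) (cong₂ (entry g) (swapHalves-↑ˡ i) (swapHalves-↑ˡ i)))))

    traceSum≡0 : ∀ (G : Mat (n ℕ.+ n) → Set) → (∀ g → G g → G (conjSwap g)) →
      ∀ gs → Unique gs → (∀ g → (g ∈ gs → G g) × (G g → g ∈ gs)) → sum (map Tr gs) ≡ 0#
    traceSum≡0 G conjSwap-closed gs gs-unique gs-lists-G = begin
      sum (map Tr gs)                                          ≡⟨ cong sum (map-cong Tr≡topLeftTrace+topLeftTrace∘conjSwap gs) ⟩
      sum (map (λ g → topLeftTrace g + topLeftTrace (conjSwap g)) gs)    ≡⟨ sum-map-+ topLeftTrace (topLeftTrace ∘ conjSwap) gs ⟩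
      sum (map topLeftTrace gs) + sum (map (topLeftTrace ∘ conjSwap) gs) ≡⟨ cong (sum (map topLeftTrace gs) +_) (sum-map-∘-↭ topLeftTrace conjSwap conjSwap↭) ⟩
      sum (map topLeftTrace gs) + sum (map topLeftTrace gs)              ≡⟨ x+x≡0 _ ⟩
      0#                                                       ∎
      where
        open ≡-Reasoning
        conjSwap-∈ : ∀ {g} → g ∈ gs → conjSwap g ∈ gs
        conjSwap-∈ {g} g∈gs = proj₂ (gs-lists-G (conjSwap g)) (conjSwap-closed g (proj₁ (gs-lists-G g) g∈gs))
        conjSwap↭ : map conjSwap gs ↭ gs
        conjSwap↭ = map-↭ conjSwap conjSwap conjSwap-involutive conjSwap-involutive conjSwap-∈ conjSwap-∈ gs-unique

    conjSwap-closed⇒SymmetricWeightDistribution : ∀ (G : Mat (n ℕ.+ n) → Set) →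
      (∀ g → G g → G (conjSwap g)) → SymmetricWeightDistribution G
    conjSwap-closed⇒SymmetricWeightDistribution G conjSwap-closed gs gs-unique gs-lists-G =
      traceSum≡0⇒weightCount-symmetric gs (traceSum≡0 G conjSwap-closed gs gs-unique gs-lists-G)

  O⁺-SymmetricWeightDistribution : ∀ n → SymmetricWeightDistribution (InO⁺ n)
  O⁺-SymmetricWeightDistribution n = conjSwap-closed⇒SymmetricWeightDistribution (InO⁺ n) conjSwap-InO⁺
    where open SwapHalves n

  SO⁺-SymmetricWeightDistribution : ∀ n → SymmetricWeightDistribution (InSO⁺ n)
  SO⁺-SymmetricWeightDistribution n = conjSwap-closed⇒SymmetricWeightDistribution (InSO⁺ n) conjSwap-InSO⁺
    where open SwapHalves n

corollary16 : (r : ℕ) (F : FiniteField r) →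
    FieldDefs.SymmetricWeightDistribution F (FieldDefs.InSO⁺ F 1)
    × FieldDefs.SymmetricWeightDistribution F (FieldDefs.InO⁺ F 1)
    × FieldDefs.SymmetricWeightDistribution F (FieldDefs.InSO⁺ F 2)
corollary16 r F = SO⁺-SymmetricWeightDistribution F 1 , O⁺-SymmetricWeightDistribution F 1 , SO⁺-SymmetricWeightDistribution F 2
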